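{- For any integer $d\ge1$, any prime $\ell$ and any $n\in\mathbb Z$, $$\sum_{\substack{g\in(\mathbb Z/\ell^2\mathbb Z)[t],\ \deg(g)\le d\\ g(n)\equiv0\bmod \ell^2}}\varrho_g(\ell^2)=\ell^{2d}\left(3-\frac2\ell\right)\qquad\text{and}\qquad\sum_{\substack{g\in(\mathbb Z/\ell^2\mathbb Z)[t]\\ \deg(g)\le d}}\varrho_g(\ell^2)^2=\ell^{2d+2}\left(3-\frac2\ell\right).$$
   Context: Polynomials $g\in(\mathbb Z/\ell^2\mathbb Z)[t]$ with $\deg(g)\le d$ are identified with coefficient vectors $(c_0,\dots,c_d)\in(\mathbb Z/\ell^2\mathbb Z)^{d+1}$. For such $g$, $\varrho_g(\ell^2):=\#\{t\in\mathbb Z/\ell^2\mathbb Z:\ g(t)=0\}$. -}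

module Defs where

open import Data.Nat using (ℕ; zero; suc; _+_; _*_; _^_)
open import Data.Fin using (Fin; toℕ)
open import Data.Vec using (Vec; []; _∷_)
open import Data.List using (List; []; _∷_; map; concatMap; filter; length; allFin)
open import Data.Nat.ListAction using (sum)
open import Data.Integer using (ℤ; +_)
import Data.Integer as ℤ
open import Data.Integer.Divisibility.Signed using (_∣_; _∣?_)
open import Relation.Nullary using (Dec)

allVecs : (m k : ℕ) → List (Vec (Fin m) k)
allVecs m zero    = [] ∷ []
allVecs m (suc k) = concatMap (λ c → map (c ∷_) (allVecs m k)) (allFin m)

-- A polynomial of degree ≤ d over ℤ/mℤ is its coefficient vector (c₀,…,c_d),
-- each coefficient represented by its canonical residue in {0,…,m-1}.
Poly : ℕ → ℕ → Set
Poly m d = Vec (Fin m) (suc d)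

evalℤ : ∀ {m k} → Vec (Fin m) k → ℤ → ℤ
evalℤ []       x = + 0
evalℤ (c ∷ cs) x = + toℕ c ℤ.+ x ℤ.* evalℤ cs x

-- g(x) ≡ 0 mod m   (as integers; well-defined on residues)
IsRootMod : ∀ {m k} → Vec (Fin m) k → ℤ → Set
IsRootMod {m} g x = (+ m) ∣ evalℤ g x

isRootMod? : ∀ {m k} (g : Vec (Fin m) k) (x : ℤ) → Dec (IsRootMod g x)
isRootMod? {m} g x = (+ m) ∣? evalℤ g x

ϱ : ∀ {m k} → Vec (Fin m) k → ℕ
ϱ {m} g = length (filter (λ t → isRootMod? g (+ toℕ t)) (allFin m))

S₁ : (ℓ d : ℕ) → ℤ → ℕ
S₁ ℓ d n = sum (map ϱ (filter (λ g → isRootMod? g n) (allVecs (ℓ ^ 2) (suc d))))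

S₂ : (ℓ d : ℕ) → ℕ
S₂ ℓ d = sum (map (λ g → ϱ g * ϱ g) (allVecs (ℓ ^ 2) (suc d)))

{-# OPTIONS --safe #-}
module Submission where

-- Exchanging sums, S₁(n) = Σₜ #{g : g(n) ≡ g(t) ≡ 0 mod ℓ²} and S₂ = Σₙ S₁(n).
-- Write g = c₀ + c₁x + x²h. The condition g(n) ≡ 0 fixes c₀, and then
-- g(t) − g(n) = (t − n)(c₁ + s) for an s depending only on h, since t − n divides
-- t²h(t) − n²h(n). The number of c₁ mod ℓ² with ℓ² ∣ (t − n)(c₁ + s) is gcd(t − n, ℓ²),
-- so S₁(n) = ℓ^(2d−2) Σₜ gcd(t − n, ℓ²) = ℓ^(2d−2) (ℓ² + 2ℓ(ℓ − 1)).

module FiniteSums where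

  open import Data.Nat using (ℕ; zero; suc; _+_; _*_; _^_; _<_; s≤s; z≤n)
  open import Data.Nat.Properties
  open import Data.Nat.ListAction using (sum)
  open import Data.Nat.ListAction.Properties using (sum-++)
  open import Data.List using (List; []; _∷_; map; filter; length; concatMap; allFin; tabulate; _++_)
  open import Data.List.Properties using (map-++; map-∘; map-tabulate)
  open import Data.Fin using (Fin; toℕ)
  open import Data.Vec using (Vec; _∷_)
  open import Data.Bool using (true; false; if_then_else_)
  open import Algebra.Properties.CommutativeSemigroup +-commutativeSemigroup using (interchange)
  open import Function using (id; _∘_)
  open import Function.Bundles using (_⇔_)
  open import Relation.Nullary using (Dec; yes; no; does; ¬_)
  open import Relation.Nullary.Decidable using (does-⇔; dec-true; dec-false)
  open import Relation.Unary using (Pred; Decidable)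
  open import Relation.Binary.PropositionalEquality
  open import Defs using (allVecs)

  𝟙 : ∀ {p} {P : Set p} → Dec P → ℕ
  𝟙 P? = if does P? then 1 else 0

  𝟙-cong : ∀ {p q} {P : Set p} {Q : Set q} → P ⇔ Q → (P? : Dec P) (Q? : Dec Q) → 𝟙 P? ≡ 𝟙 Q?
  𝟙-cong P⇔Q P? Q? = cong (λ b → if b then 1 else 0) (does-⇔ P⇔Q P? Q?)

  𝟙-*-cong : ∀ {p q r} {P : Set p} {Q : Set q} {R : Set r} → (P → Q ⇔ R) →
             (P? : Dec P) (Q? : Dec Q) (R? : Dec R) → 𝟙 P? * 𝟙 Q? ≡ 𝟙 P? * 𝟙 R?
  𝟙-*-cong Q⇔R (yes p) Q? R? = cong (_+ 0) (𝟙-cong (Q⇔R p) Q? R?)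
  𝟙-*-cong Q⇔R (no _)  Q? R? = refl

  𝟙-yes : ∀ {p} {P : Set p} (P? : Dec P) → P → 𝟙 P? ≡ 1
  𝟙-yes P? p rewrite dec-true P? p = refl

  𝟙-no : ∀ {p} {P : Set p} (P? : Dec P) → ¬ P → 𝟙 P? ≡ 0
  𝟙-no P? ¬p rewrite dec-false P? ¬p = refl

  ∑ : ∀ {a} {A : Set a} → List A → (A → ℕ) → ℕ
  ∑ xs f = sum (map f xs)

  infix 5 ∑
  syntax ∑ xs (λ x → e) = ∑[ x ∈ xs ] e

  module _ {a} {A : Set a} where

    ∑-cong : ∀ {f g : A → ℕ} (xs : List A) → (∀ x → f x ≡ g x) → ∑ xs f ≡ ∑ xs g
    ∑-cong []       f≗g = refl
    ∑-cong (x ∷ xs) f≗g = cong₂ _+_ (f≗g x) (∑-cong xs f≗g)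

    ∑-++ : (xs ys : List A) (f : A → ℕ) → ∑ (xs ++ ys) f ≡ ∑ xs f + ∑ ys f
    ∑-++ xs ys f = trans (cong sum (map-++ f xs ys)) (sum-++ (map f xs) (map f ys))

    ∑-+ : (xs : List A) (f g : A → ℕ) → ∑[ x ∈ xs ] (f x + g x) ≡ ∑ xs f + ∑ xs g
    ∑-+ []       f g = refl
    ∑-+ (x ∷ xs) f g = trans (cong (f x + g x +_) (∑-+ xs f g)) (interchange (f x) (g x) _ _)

    ∑-filter : ∀ {p} {P : Pred A p} (P? : Decidable P) (xs : List A) (f : A → ℕ) →
               ∑ (filter P? xs) f ≡ ∑[ x ∈ xs ] 𝟙 (P? x) * f x
    ∑-filter P? []       f = refl
    ∑-filter P? (x ∷ xs) f with does (P? x)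
    ... | true  = cong₂ _+_ (sym (+-identityʳ (f x))) (∑-filter P? xs f)
    ... | false = ∑-filter P? xs f

    length-filter : ∀ {p} {P : Pred A p} (P? : Decidable P) (xs : List A) →
                    length (filter P? xs) ≡ ∑[ x ∈ xs ] 𝟙 (P? x)
    length-filter P? []       = refl
    length-filter P? (x ∷ xs) with does (P? x)
    ... | true  = cong suc (length-filter P? xs)
    ... | false = length-filter P? xs

  module _ {a b} {A : Set a} {B : Set b} where

    ∑-map : (g : A → B) (xs : List A) (f : B → ℕ) → ∑ (map g xs) f ≡ ∑[ x ∈ xs ] f (g x)
    ∑-map g xs f = cong sum (sym (map-∘ xs))

    ∑-concatMap : (g : A → List B) (xs : List A) (f : B → ℕ) →
                  ∑ (concatMap g xs) f ≡ ∑[ x ∈ xs ] ∑ (g x) f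
    ∑-concatMap g []       f = refl
    ∑-concatMap g (x ∷ xs) f =
      trans (∑-++ (g x) (concatMap g xs) f) (cong (∑ (g x) f +_) (∑-concatMap g xs f))

    ∑-comm : (xs : List A) (ys : List B) (f : A → B → ℕ) →
             ∑[ x ∈ xs ] ∑[ y ∈ ys ] f x y ≡ ∑[ y ∈ ys ] ∑[ x ∈ xs ] f x y
    ∑-comm []       ys f = sym (∑-zero ys)
      where
      ∑-zero : (ys : List B) → ∑[ y ∈ ys ] 0 ≡ 0
      ∑-zero []       = refl
      ∑-zero (y ∷ ys) = ∑-zero ys
    ∑-comm (x ∷ xs) ys f =
      trans (cong (∑ ys (f x) +_) (∑-comm xs ys f)) (sym (∑-+ ys (f x) (λ y → ∑[ x ∈ xs ] f x y)))

  ∑< : ℕ → (ℕ → ℕ) → ℕ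
  ∑< zero    f = 0
  ∑< (suc m) f = f 0 + ∑< m (λ i → f (suc i))

  infix 5 ∑<
  syntax ∑< m (λ i → e) = ∑[ i < m ] e

  ∑<-cong : ∀ m {f g : ℕ → ℕ} → (∀ i → i < m → f i ≡ g i) → ∑< m f ≡ ∑< m g
  ∑<-cong zero    f≗g = refl
  ∑<-cong (suc m) f≗g = cong₂ _+_ (f≗g 0 (s≤s z≤n)) (∑<-cong m (λ i i<m → f≗g (suc i) (s≤s i<m)))

  ∑<-const : ∀ m c → ∑[ i < m ] c ≡ m * c
  ∑<-const zero    c = refl
  ∑<-const (suc m) c = cong (c +_) (∑<-const m c)

  ∑<-+ : ∀ m (f g : ℕ → ℕ) → ∑[ i < m ] (f i + g i) ≡ ∑< m f + ∑< m g
  ∑<-+ zero    f g = refl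
  ∑<-+ (suc m) f g = trans (cong (f 0 + g 0 +_) (∑<-+ m (λ i → f (suc i)) (λ i → g (suc i))))
                           (interchange (f 0) (g 0) _ _)

  ∑<-*ˡ : ∀ m c (f : ℕ → ℕ) → ∑[ i < m ] c * f i ≡ c * ∑< m f
  ∑<-*ˡ zero    c f = sym (*-zeroʳ c)
  ∑<-*ˡ (suc m) c f = trans (cong (c * f 0 +_) (∑<-*ˡ m c (λ i → f (suc i))))
                            (sym (*-distribˡ-+ c (f 0) _))

  ∑<-*ʳ : ∀ m c (f : ℕ → ℕ) → ∑[ i < m ] f i * c ≡ ∑< m f * c
  ∑<-*ʳ m c f = trans (∑<-cong m (λ i _ → *-comm (f i) c)) (trans (∑<-*ˡ m c f) (*-comm c _))

  ∑<-+-split : ∀ m n (f : ℕ → ℕ) → ∑< (m + n) f ≡ ∑< m f + (∑[ i < n ] f (m + i))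
  ∑<-+-split zero    n f = refl
  ∑<-+-split (suc m) n f = trans (cong (f 0 +_) (∑<-+-split m n (λ i → f (suc i))))
                                 (sym (+-assoc (f 0) _ _))

  ∑<-𝟙-unique : ∀ m {p} {P : ℕ → Set p} (P? : ∀ i → Dec (P i)) {i₀} → i₀ < m → P i₀ →
                (∀ {i} → i < m → P i → i ≡ i₀) → ∑[ i < m ] 𝟙 (P? i) ≡ 1
  ∑<-𝟙-unique (suc m) P? {zero} _ P0 unique = cong₂ _+_ (𝟙-yes (P? 0) P0) (begin
    ∑[ i < m ] 𝟙 (P? (suc i)) ≡⟨ ∑<-cong m (λ i i<m → 𝟙-no (P? (suc i)) (1+n≢0 ∘ unique (s≤s i<m))) ⟩
    ∑[ i < m ] 0              ≡⟨ ∑<-const m 0 ⟩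
    m * 0                     ≡⟨ *-zeroʳ m ⟩
    0                         ∎)
    where open ≡-Reasoning
  ∑<-𝟙-unique (suc m) P? {suc i₀} (s≤s i₀<m) Pi₀ unique =
    cong₂ _+_ (𝟙-no (P? 0) (0≢1+n ∘ unique (s≤s z≤n)))
              (∑<-𝟙-unique m (λ i → P? (suc i)) i₀<m Pi₀ (λ i<m → suc-injective ∘ unique (s≤s i<m)))

  ∑-allFin : ∀ m (f : ℕ → ℕ) → ∑[ c ∈ allFin m ] f (toℕ c) ≡ ∑< m f
  ∑-allFin m f = trans (cong sum (map-tabulate {n = m} id (f ∘ toℕ))) (sum-tabulate m f)
    where
    sum-tabulate : ∀ m (f : ℕ → ℕ) → sum (tabulate {n = m} (f ∘ toℕ)) ≡ ∑< m f
    sum-tabulate zero    f = refl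
    sum-tabulate (suc m) f = cong (f 0 +_) (sum-tabulate m (f ∘ suc))

  ∑-comm-∑< : ∀ {a} {A : Set a} (xs : List A) m (f : A → ℕ → ℕ) →
              ∑[ x ∈ xs ] ∑< m (f x) ≡ ∑[ i < m ] ∑[ x ∈ xs ] f x i
  ∑-comm-∑< xs m f = begin
    ∑[ x ∈ xs ] ∑< m (f x)                           ≡˘⟨ ∑-cong xs (λ x → ∑-allFin m (f x)) ⟩
    ∑[ x ∈ xs ] ∑[ c ∈ allFin m ] f x (toℕ c)        ≡⟨ ∑-comm xs (allFin m) (λ x c → f x (toℕ c)) ⟩
    ∑[ c ∈ allFin m ] ∑[ x ∈ xs ] f x (toℕ c)        ≡⟨ ∑-allFin m (λ i → ∑[ x ∈ xs ] f x i) ⟩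
    ∑[ i < m ] ∑[ x ∈ xs ] f x i                     ∎
    where open ≡-Reasoning

  ∑-allVecs-suc : ∀ m k (f : Vec (Fin m) (suc k) → ℕ) →
                  ∑ (allVecs m (suc k)) f ≡ ∑[ v ∈ allVecs m k ] ∑[ c ∈ allFin m ] f (c ∷ v)
  ∑-allVecs-suc m k f = begin
    ∑ (allVecs m (suc k)) f
      ≡⟨ ∑-concatMap (λ c → map (c ∷_) (allVecs m k)) (allFin m) f ⟩
    ∑[ c ∈ allFin m ] ∑ (map (c ∷_) (allVecs m k)) f
      ≡⟨ ∑-cong (allFin m) (λ c → ∑-map (c ∷_) (allVecs m k) f) ⟩
    ∑[ c ∈ allFin m ] ∑[ v ∈ allVecs m k ] f (c ∷ v)
      ≡⟨ ∑-comm (allFin m) (allVecs m k) (λ c v → f (c ∷ v)) ⟩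
    ∑[ v ∈ allVecs m k ] ∑[ c ∈ allFin m ] f (c ∷ v) ∎
    where open ≡-Reasoning

  ∑-allVecs-const : ∀ m k c → ∑[ v ∈ allVecs m k ] c ≡ m ^ k * c
  ∑-allVecs-const m zero    c = refl
  ∑-allVecs-const m (suc k) c = begin
    ∑[ v ∈ allVecs m (suc k) ] c                     ≡⟨ ∑-allVecs-suc m k (λ _ → c) ⟩
    ∑[ v ∈ allVecs m k ] ∑[ i ∈ allFin m ] c         ≡⟨ ∑-cong (allVecs m k) (λ _ → ∑-allFin m (λ _ → c)) ⟩
    ∑[ v ∈ allVecs m k ] ∑[ i < m ] c                ≡⟨ ∑-cong (allVecs m k) (λ _ → ∑<-const m c) ⟩
    ∑[ v ∈ allVecs m k ] m * c                       ≡⟨ ∑-allVecs-const m k (m * c) ⟩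
    m ^ k * (m * c)                                  ≡˘⟨ *-assoc (m ^ k) m c ⟩
    m ^ k * m * c                                    ≡⟨ cong (_* c) (*-comm (m ^ k) m) ⟩
    m ^ suc k * c                                    ∎
    where open ≡-Reasoning

module Congruences where

  open import Data.Nat as ℕ using (ℕ; zero; suc; _<_; _^_; NonZero)
  import Data.Nat.Properties as ℕ
  open import Data.Nat.Divisibility as ℕ using (>⇒∤)
  open import Data.Nat.Primality using (Prime; euclidsLemma; prime⇒nonZero)
  open import Data.Integer using (ℤ; +_; _+_; _*_; _-_; -_; ∣_∣)
  open import Data.Integer.Properties
    using (+-injective; pos-*; pos-+; *-assoc; m-n≡m⊖n; ∣m⊝n∣≤m⊔n; ∣i∣≡0⇒i≡0; i-j≡0⇒i≡j; abs-*)
  open import Data.Integer.DivMod using (_%ℕ_; _/ℕ_; n%ℕd<d; a≡a%ℕn+[a/ℕn]*n)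
  open import Data.Integer.Divisibility.Signed
  open import Data.Integer.Tactic.RingSolver using (solve-∀)
  open import Data.Nat.Tactic.RingSolver renaming (solve-∀ to ℕ-solve-∀)
  open import Data.Fin using (Fin; toℕ)
  open import Data.Vec using (Vec; []; _∷_)
  open import Data.List using (allFin)
  open import Data.Product using (∃-syntax; _×_; _,_)
  open import Data.Sum using (inj₁; inj₂)
  open import Function using (_∘_)
  open import Function.Bundles using (_⇔_; mk⇔)
  open import Relation.Nullary using (¬_; yes; no; contradiction)
  open import Relation.Binary.PropositionalEquality
  open import Defs using (evalℤ; isRootMod?)
  open FiniteSums

  ∣∧<⇒≡0 : ∀ {k m} → k ℕ.∣ m → m < k → m ≡ 0
  ∣∧<⇒≡0 {m = zero}  _   _   = refl
  ∣∧<⇒≡0 {m = suc _} k∣m m<k = contradiction k∣m (>⇒∤ m<k)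

  residue-unique : ∀ {k i j} → i < k → j < k → + k ∣ + i - + j → i ≡ j
  residue-unique {k} {i} {j} i<k j<k k∣i-j =
    +-injective (i-j≡0⇒i≡j (+ i) (+ j) (∣i∣≡0⇒i≡0 (∣∧<⇒≡0 (∣⇒∣ᵤ k∣i-j) ∣i-j∣<k)))
    where
    ∣i-j∣<k : ∣ + i - + j ∣ < k
    ∣i-j∣<k = ℕ.≤-<-trans (subst (ℕ._≤ i ℕ.⊔ j) (cong ∣_∣ (sym (m-n≡m⊖n i j))) (∣m⊝n∣≤m⊔n i j))
                          (ℕ.⊔-pres-<m i<k j<k)

  residue-exists : ∀ k .{{_ : NonZero k}} a → ∃[ i ] i < k × + k ∣ + i + a
  residue-exists k a = i , n%ℕd<d (- a) k , divides (- q) i+a≡-q*k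
    where
    i = (- a) %ℕ k
    q = (- a) /ℕ k
    i+a≡-q*k : + i + a ≡ (- q) * + k
    i+a≡-q*k = begin
      + i + a                    ≡⟨ shift (+ i) a q (+ k) ⟩
      (+ i + q * + k) + a - q * + k ≡˘⟨ cong (λ z → z + a - q * + k) (a≡a%ℕn+[a/ℕn]*n (- a) k) ⟩
      (- a) + a - q * + k        ≡⟨ cancel a q (+ k) ⟩
      (- q) * + k                ∎
      where
      open ≡-Reasoning
      shift : ∀ x a q k → x + a ≡ (x + q * k) + a - q * k
      shift = solve-∀
      cancel : ∀ a q k → (- a) + a - q * k ≡ (- q) * k
      cancel = solve-∀

  ∑<k-𝟙[k∣i+a]≡1 : ∀ k .{{_ : NonZero k}} a → ∑[ i < k ] 𝟙 (+ k ∣? + i + a) ≡ 1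
  ∑<k-𝟙[k∣i+a]≡1 k a with residue-exists k a
  ... | i₀ , i₀<k , k∣i₀+a = ∑<-𝟙-unique k (λ i → + k ∣? + i + a) i₀<k k∣i₀+a
    (λ {i} i<k k∣i+a → residue-unique i<k i₀<k
      (subst (+ k ∣_) (difference (+ i) (+ i₀) a) (∣m∣n⇒∣m-n k∣i+a k∣i₀+a)))
    where
    difference : ∀ x y a → (x + a) - (y + a) ≡ x - y
    difference = solve-∀

  ∑<jk-𝟙[k∣i+a]≡j : ∀ j k .{{_ : NonZero k}} a → ∑[ i < j ℕ.* k ] 𝟙 (+ k ∣? + i + a) ≡ j
  ∑<jk-𝟙[k∣i+a]≡j zero    k a = refl
  ∑<jk-𝟙[k∣i+a]≡j (suc j) k a = begin
    ∑[ i < k ℕ.+ j ℕ.* k ] 𝟙 (+ k ∣? + i + a)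
      ≡⟨ ∑<-+-split k (j ℕ.* k) _ ⟩
    (∑[ i < k ] 𝟙 (+ k ∣? + i + a)) ℕ.+ (∑[ i < j ℕ.* k ] 𝟙 (+ k ∣? + (k ℕ.+ i) + a))
      ≡⟨ cong₂ ℕ._+_ (∑<k-𝟙[k∣i+a]≡1 k a)
                     (∑<-cong (j ℕ.* k) (λ i _ → 𝟙-cong (period i) (+ k ∣? _) (+ k ∣? _))) ⟩
    suc (∑[ i < j ℕ.* k ] 𝟙 (+ k ∣? + i + a))
      ≡⟨ cong suc (∑<jk-𝟙[k∣i+a]≡j j k a) ⟩
    suc j ∎
    where
    open ≡-Reasoning
    shift : ∀ i → + (k ℕ.+ i) + a ≡ (+ i + a) + + k
    shift i = trans (cong (_+ a) (pos-+ k i)) (reorder (+ k) (+ i) a)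
      where
      reorder : ∀ k i a → k + i + a ≡ (i + a) + k
      reorder = solve-∀
    period : ∀ i → (+ k ∣ + (k ℕ.+ i) + a) ⇔ (+ k ∣ + i + a)
    period i = mk⇔ (λ k∣ → ∣m+n∣n⇒∣m (subst (+ k ∣_) (shift i) k∣) ∣-refl)
                   (λ k∣ → subst (+ k ∣_) (sym (shift i)) (∣m∣n⇒∣m+n k∣ ∣-refl))

  ∣-*-diff : ∀ {x y a b} → x - y ∣ a - b → x - y ∣ x * a - y * b
  ∣-*-diff {x} {y} {a} {b} x-y∣a-b =
    subst (x - y ∣_) (split x y a b) (∣m∣n⇒∣m+n (∣m⇒∣m*n a ∣-refl) (∣n⇒∣m*n y x-y∣a-b))
    where
    split : ∀ x y a b → (x - y) * a + y * (a - b) ≡ x * a - y * b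
    split = solve-∀

  x-y∣f[x]-f[y] : ∀ {m k} (f : Vec (Fin m) k) x y → x - y ∣ evalℤ f x - evalℤ f y
  x-y∣f[x]-f[y] []      x y = divides (+ 0) refl
  x-y∣f[x]-f[y] (c ∷ f) x y =
    subst (x - y ∣_) (cancel (+ toℕ c) (x * evalℤ f x) (y * evalℤ f y))
          (∣-*-diff {x} {y} (x-y∣f[x]-f[y] f x y))
    where
    cancel : ∀ c a b → a - b ≡ (c + a) - (c + b)
    cancel = solve-∀

  eliminate-constant-term : ∀ m .{{_ : NonZero m}} {k} (v : Vec (Fin m) k) n t →
    ∑[ c ∈ allFin m ] 𝟙 (isRootMod? (c ∷ v) n) ℕ.* 𝟙 (isRootMod? (c ∷ v) t)
      ≡ 𝟙 (+ m ∣? t * evalℤ v t - n * evalℤ v n)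
  eliminate-constant-term m v n t = begin
    ∑[ c ∈ allFin m ] 𝟙 (isRootMod? (c ∷ v) n) ℕ.* 𝟙 (isRootMod? (c ∷ v) t)
      ≡⟨ ∑-allFin m (λ i → 𝟙 (+ m ∣? + i + A) ℕ.* 𝟙 (+ m ∣? + i + B)) ⟩
    ∑[ i < m ] 𝟙 (+ m ∣? + i + A) ℕ.* 𝟙 (+ m ∣? + i + B)
      ≡⟨ ∑<-cong m (λ i _ → 𝟙-*-cong (same-root i) (+ m ∣? _) (+ m ∣? _) (+ m ∣? B - A)) ⟩
    ∑[ i < m ] 𝟙 (+ m ∣? + i + A) ℕ.* 𝟙 (+ m ∣? B - A)
      ≡⟨ ∑<-*ʳ m _ _ ⟩
    (∑[ i < m ] 𝟙 (+ m ∣? + i + A)) ℕ.* 𝟙 (+ m ∣? B - A)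
      ≡⟨ cong (ℕ._* 𝟙 (+ m ∣? B - A)) (∑<k-𝟙[k∣i+a]≡1 m A) ⟩
    1 ℕ.* 𝟙 (+ m ∣? B - A)
      ≡⟨ ℕ.*-identityˡ _ ⟩
    𝟙 (+ m ∣? B - A) ∎
    where
    open ≡-Reasoning
    A = n * evalℤ v n
    B = t * evalℤ v t
    difference : ∀ x A B → (x + B) - (x + A) ≡ B - A
    difference = solve-∀
    shift : ∀ x A B → (x + A) + (B - A) ≡ x + B
    shift = solve-∀
    same-root : ∀ i → + m ∣ + i + A → (+ m ∣ + i + B) ⇔ (+ m ∣ B - A)
    same-root i m∣i+A =
      mk⇔ (λ m∣i+B → subst (+ m ∣_) (difference (+ i) A B) (∣m∣n⇒∣m-n m∣i+B m∣i+A))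
          (λ m∣B-A → subst (+ m ∣_) (shift (+ i) A B) (∣m∣n⇒∣m+n m∣i+A m∣B-A))

  prime-∣-cancelˡ : ∀ {ℓ} → Prime ℓ → ∀ {u y} → ¬ (+ ℓ ∣ u) → + ℓ ∣ u * y → + ℓ ∣ y
  prime-∣-cancelˡ {ℓ} ℓ-prime {u} {y} ℓ∤u ℓ∣uy
    with euclidsLemma ∣ u ∣ ∣ y ∣ ℓ-prime (subst (ℓ ℕ.∣_) (abs-* u y) (∣⇒∣ᵤ ℓ∣uy))
  ... | inj₁ ℓ∣u = contradiction (∣ᵤ⇒∣ ℓ∣u) ℓ∤u
  ... | inj₂ ℓ∣y = ∣ᵤ⇒∣ ℓ∣y

  prime²-∣-cancelˡ : ∀ {ℓ} → Prime ℓ → ∀ {u y} → ¬ (+ ℓ ∣ u) → + ℓ * + ℓ ∣ u * y → + ℓ * + ℓ ∣ y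
  prime²-∣-cancelˡ {ℓ} ℓ-prime {u} {y} ℓ∤u ℓ²∣uy
    with prime-∣-cancelˡ ℓ-prime ℓ∤u (∣-trans (∣m⇒∣m*n (+ ℓ) ∣-refl) ℓ²∣uy)
  ... | divides q y≡qℓ = subst (+ ℓ * + ℓ ∣_) (sym y≡qℓ) (*-monoˡ-∣ (+ ℓ) ℓ∣q)
    where
    instance
      ℓ≢0 : NonZero ℓ
      ℓ≢0 = prime⇒nonZero ℓ-prime
    ℓ∣uq : + ℓ ∣ u * q
    ℓ∣uq = *-cancelʳ-∣ (+ ℓ)
      (subst (+ ℓ * + ℓ ∣_) (trans (cong (u *_) y≡qℓ) (sym (*-assoc u q (+ ℓ)))) ℓ²∣uy)
    ℓ∣q : + ℓ ∣ q
    ℓ∣q = prime-∣-cancelˡ ℓ-prime ℓ∤u ℓ∣uq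

  module Modℓ² {ℓ-1 : ℕ} (ℓ-prime : Prime (suc ℓ-1)) where

    ℓ : ℕ
    ℓ = suc ℓ-1

    ℓ^2≡ℓ*ℓ : ℓ ^ 2 ≡ ℓ ℕ.* ℓ
    ℓ^2≡ℓ*ℓ = cong (ℓ ℕ.*_) (ℕ.*-identityʳ ℓ)

    +ℓ^2≡+ℓ*+ℓ : + (ℓ ^ 2) ≡ + ℓ * + ℓ
    +ℓ^2≡+ℓ*+ℓ = trans (cong +_ ℓ^2≡ℓ*ℓ) (pos-* ℓ ℓ)

    -- gcd(δ, ℓ²) ∈ {1, ℓ, ℓ²}, written with indicators so that its sums over residues are linear.
    gcdℓ² : ℤ → ℕ
    gcdℓ² δ = 1 ℕ.+ ℓ-1 ℕ.* 𝟙 (+ ℓ ∣? δ) ℕ.+ ℓ ℕ.* ℓ-1 ℕ.* 𝟙 (+ (ℓ ^ 2) ∣? δ)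

    ℓ²∣⇒ℓ∣ : ∀ {x} → + (ℓ ^ 2) ∣ x → + ℓ ∣ x
    ℓ²∣⇒ℓ∣ {x} ℓ²∣x = ∣-trans (∣m⇒∣m*n (+ ℓ) ∣-refl) (subst (_∣ x) +ℓ^2≡+ℓ*+ℓ ℓ²∣x)

    gcdℓ²≡ℓ² : ∀ {δ} → + (ℓ ^ 2) ∣ δ → gcdℓ² δ ≡ ℓ ^ 2
    gcdℓ²≡ℓ² {δ} ℓ²∣δ
      rewrite 𝟙-yes (+ ℓ ∣? δ) (ℓ²∣⇒ℓ∣ ℓ²∣δ) | 𝟙-yes (+ (ℓ ^ 2) ∣? δ) ℓ²∣δ = arithmetic ℓ-1
      where
      arithmetic : ∀ p → 1 ℕ.+ p ℕ.* 1 ℕ.+ (1 ℕ.+ p) ℕ.* p ℕ.* 1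
                         ≡ (1 ℕ.+ p) ℕ.* ((1 ℕ.+ p) ℕ.* 1)
      arithmetic = ℕ-solve-∀

    gcdℓ²≡ℓ : ∀ {δ} → ¬ (+ (ℓ ^ 2) ∣ δ) → + ℓ ∣ δ → gcdℓ² δ ≡ ℓ
    gcdℓ²≡ℓ {δ} ℓ²∤δ ℓ∣δ
      rewrite 𝟙-yes (+ ℓ ∣? δ) ℓ∣δ | 𝟙-no (+ (ℓ ^ 2) ∣? δ) ℓ²∤δ = arithmetic ℓ-1
      where
      arithmetic : ∀ p → 1 ℕ.+ p ℕ.* 1 ℕ.+ (1 ℕ.+ p) ℕ.* p ℕ.* 0 ≡ 1 ℕ.+ p
      arithmetic = ℕ-solve-∀

    gcdℓ²≡1 : ∀ {δ} → ¬ (+ ℓ ∣ δ) → gcdℓ² δ ≡ 1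
    gcdℓ²≡1 {δ} ℓ∤δ
      rewrite 𝟙-no (+ ℓ ∣? δ) ℓ∤δ | 𝟙-no (+ (ℓ ^ 2) ∣? δ) (ℓ∤δ ∘ ℓ²∣⇒ℓ∣) = arithmetic ℓ-1
      where
      arithmetic : ∀ p → 1 ℕ.+ p ℕ.* 0 ℕ.+ (1 ℕ.+ p) ℕ.* p ℕ.* 0 ≡ 1
      arithmetic = ℕ-solve-∀

    ∑-𝟙[ℓ²∣δ[c+s]]≡gcdℓ² : ∀ δ s → ∑[ c < ℓ ^ 2 ] 𝟙 (+ (ℓ ^ 2) ∣? δ * (+ c + s)) ≡ gcdℓ² δ
    ∑-𝟙[ℓ²∣δ[c+s]]≡gcdℓ² δ s with + (ℓ ^ 2) ∣? δ | + ℓ ∣? δ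
    ... | yes ℓ²∣δ | _ = begin
      ∑[ c < ℓ ^ 2 ] 𝟙 (+ (ℓ ^ 2) ∣? δ * (+ c + s))
        ≡⟨ ∑<-cong (ℓ ^ 2) (λ c _ → 𝟙-yes (+ (ℓ ^ 2) ∣? _) (∣m⇒∣m*n (+ c + s) ℓ²∣δ)) ⟩
      ∑[ c < ℓ ^ 2 ] 1
        ≡⟨ ∑<-const (ℓ ^ 2) 1 ⟩
      ℓ ^ 2 ℕ.* 1
        ≡⟨ ℕ.*-identityʳ (ℓ ^ 2) ⟩
      ℓ ^ 2
        ≡˘⟨ gcdℓ²≡ℓ² ℓ²∣δ ⟩
      gcdℓ² δ ∎
      where open ≡-Reasoning
    ... | no ℓ²∤δ | yes ℓ∣δ@(divides u δ≡uℓ) = begin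
      ∑[ c < ℓ ^ 2 ] 𝟙 (+ (ℓ ^ 2) ∣? δ * (+ c + s))
        ≡⟨ ∑<-cong (ℓ ^ 2) (λ c _ → 𝟙-cong (reduce (+ c + s)) (+ (ℓ ^ 2) ∣? _) (+ ℓ ∣? _)) ⟩
      ∑[ c < ℓ ^ 2 ] 𝟙 (+ ℓ ∣? + c + s)
        ≡⟨ cong (λ m → ∑[ c < m ] 𝟙 (+ ℓ ∣? + c + s)) ℓ^2≡ℓ*ℓ ⟩
      ∑[ c < ℓ ℕ.* ℓ ] 𝟙 (+ ℓ ∣? + c + s)
        ≡⟨ ∑<jk-𝟙[k∣i+a]≡j ℓ ℓ s ⟩
      ℓ
        ≡˘⟨ gcdℓ²≡ℓ ℓ²∤δ ℓ∣δ ⟩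
      gcdℓ² δ ∎
      where
      open ≡-Reasoning
      ℓ∤u : ¬ (+ ℓ ∣ u)
      ℓ∤u ℓ∣u = ℓ²∤δ (subst₂ _∣_ (sym +ℓ^2≡+ℓ*+ℓ) (sym δ≡uℓ) (*-monoˡ-∣ (+ ℓ) ℓ∣u))
      δx≡uxℓ : ∀ x → δ * x ≡ u * x * + ℓ
      δx≡uxℓ x = trans (cong (_* x) δ≡uℓ) (commute u (+ ℓ) x)
        where
        commute : ∀ u ℓ x → u * ℓ * x ≡ u * x * ℓ
        commute = solve-∀
      reduce : ∀ x → (+ (ℓ ^ 2) ∣ δ * x) ⇔ (+ ℓ ∣ x)
      reduce x = mk⇔
        (λ ℓ²∣δx → prime-∣-cancelˡ ℓ-prime ℓ∤u
          (*-cancelʳ-∣ (+ ℓ) (subst₂ _∣_ +ℓ^2≡+ℓ*+ℓ (δx≡uxℓ x) ℓ²∣δx)))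
        (λ ℓ∣x → subst₂ _∣_ (sym +ℓ^2≡+ℓ*+ℓ) (sym (δx≡uxℓ x)) (*-monoˡ-∣ (+ ℓ) (∣n⇒∣m*n u ℓ∣x)))
    ... | no _ | no ℓ∤δ = begin
      ∑[ c < ℓ ^ 2 ] 𝟙 (+ (ℓ ^ 2) ∣? δ * (+ c + s))
        ≡⟨ ∑<-cong (ℓ ^ 2) (λ c _ → 𝟙-cong (reduce (+ c + s)) (+ (ℓ ^ 2) ∣? _) (+ (ℓ ^ 2) ∣? _))
        ⟩
      ∑[ c < ℓ ^ 2 ] 𝟙 (+ (ℓ ^ 2) ∣? + c + s)
        ≡⟨ ∑<k-𝟙[k∣i+a]≡1 (ℓ ^ 2) s ⟩
      1
        ≡˘⟨ gcdℓ²≡1 ℓ∤δ ⟩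
      gcdℓ² δ ∎
      where
      open ≡-Reasoning
      reduce : ∀ x → (+ (ℓ ^ 2) ∣ δ * x) ⇔ (+ (ℓ ^ 2) ∣ x)
      reduce x = mk⇔
        (λ ℓ²∣δx → subst (_∣ x) (sym +ℓ^2≡+ℓ*+ℓ)
          (prime²-∣-cancelˡ ℓ-prime ℓ∤δ (subst (_∣ δ * x) +ℓ^2≡+ℓ*+ℓ ℓ²∣δx)))
        (∣n⇒∣m*n δ)

    eliminate-linear-term : ∀ {k} (h : Vec (Fin (ℓ ^ 2)) k) n t →
      ∑[ c ∈ allFin (ℓ ^ 2) ] 𝟙 (+ (ℓ ^ 2) ∣? t * evalℤ (c ∷ h) t - n * evalℤ (c ∷ h) n)
        ≡ gcdℓ² (t - n)
    -- s is the quotient of t²h(t) − n²h(n) by t − n.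
    eliminate-linear-term h n t with ∣-*-diff {t} {n} (∣-*-diff {t} {n} (x-y∣f[x]-f[y] h t n))
    ... | divides s R≡s[t-n] = begin
      ∑[ c ∈ allFin (ℓ ^ 2) ] 𝟙 (+ (ℓ ^ 2) ∣? t * evalℤ (c ∷ h) t - n * evalℤ (c ∷ h) n)
        ≡⟨ ∑-allFin (ℓ ^ 2) (λ c → 𝟙 (+ (ℓ ^ 2) ∣? t * (+ c + t * Ht) - n * (+ c + n * Hn))) ⟩
      ∑[ c < ℓ ^ 2 ] 𝟙 (+ (ℓ ^ 2) ∣? t * (+ c + t * Ht) - n * (+ c + n * Hn))
        ≡⟨ ∑<-cong (ℓ ^ 2) (λ c _ → cong (λ z → 𝟙 (+ (ℓ ^ 2) ∣? z)) (factor (+ c))) ⟩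
      ∑[ c < ℓ ^ 2 ] 𝟙 (+ (ℓ ^ 2) ∣? (t - n) * (+ c + s))
        ≡⟨ ∑-𝟙[ℓ²∣δ[c+s]]≡gcdℓ² (t - n) s ⟩
      gcdℓ² (t - n) ∎
      where
      open ≡-Reasoning
      Ht = evalℤ h t
      Hn = evalℤ h n
      expand : ∀ c t n Ht Hn → t * (c + t * Ht) - n * (c + n * Hn)
                               ≡ (t - n) * c + (t * (t * Ht) - n * (n * Hn))
      expand = solve-∀
      collect : ∀ c s δ → δ * c + s * δ ≡ δ * (c + s)
      collect = solve-∀
      factor : ∀ c → t * (c + t * Ht) - n * (c + n * Hn) ≡ (t - n) * (c + s)
      factor c = trans (expand c t n Ht Hn)
                       (trans (cong (λ r → (t - n) * c + r) R≡s[t-n]) (collect c s (t - n)))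

module Counting where

  open import Data.Nat using (ℕ; suc; _+_; _*_; _^_; _∸_)
  open import Data.Nat.Properties
  open import Data.Nat.Primality using (Prime)
  open import Data.Nat.Tactic.RingSolver using (solve-∀)
  open import Data.Integer as ℤ using (ℤ; +_)
  open import Data.Integer.Divisibility.Signed using (_∣?_)
  open import Data.Fin using (Fin; toℕ)
  open import Data.Vec using (Vec; _∷_)
  open import Data.List using (allFin)
  open import Relation.Binary.PropositionalEquality
  open import Defs
  open FiniteSums
  open Congruences

  commonRoots : (m d : ℕ) → ℤ → ℤ → ℕ
  commonRoots m d n t = ∑[ g ∈ allVecs m (suc d) ] 𝟙 (isRootMod? g n) * 𝟙 (isRootMod? g t)

  ϱ≡∑𝟙 : ∀ {m k} (g : Vec (Fin m) k) → ϱ g ≡ ∑[ t < m ] 𝟙 (isRootMod? g (+ t))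
  ϱ≡∑𝟙 {m} g = trans (length-filter (λ t → isRootMod? g (+ toℕ t)) (allFin m))
                     (∑-allFin m (λ t → 𝟙 (isRootMod? g (+ t))))

  S₁≡∑commonRoots : ∀ ℓ d n → S₁ ℓ d n ≡ ∑[ t < ℓ ^ 2 ] commonRoots (ℓ ^ 2) d n (+ t)
  S₁≡∑commonRoots ℓ d n = begin
    S₁ ℓ d n
      ≡⟨ ∑-filter (λ g → isRootMod? g n) G ϱ ⟩
    ∑[ g ∈ G ] 𝟙 (isRootMod? g n) * ϱ g
      ≡⟨ ∑-cong G (λ g → cong (𝟙 (isRootMod? g n) *_) (ϱ≡∑𝟙 g)) ⟩
    ∑[ g ∈ G ] 𝟙 (isRootMod? g n) * (∑[ t < ℓ ^ 2 ] 𝟙 (isRootMod? g (+ t)))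
      ≡˘⟨ ∑-cong G (λ g → ∑<-*ˡ (ℓ ^ 2) (𝟙 (isRootMod? g n)) _) ⟩
    ∑[ g ∈ G ] ∑[ t < ℓ ^ 2 ] 𝟙 (isRootMod? g n) * 𝟙 (isRootMod? g (+ t))
      ≡⟨ ∑-comm-∑< G (ℓ ^ 2) _ ⟩
    ∑[ t < ℓ ^ 2 ] commonRoots (ℓ ^ 2) d n (+ t) ∎
    where
    open ≡-Reasoning
    G = allVecs (ℓ ^ 2) (suc d)

  S₂≡∑S₁ : ∀ ℓ d → S₂ ℓ d ≡ ∑[ n < ℓ ^ 2 ] S₁ ℓ d (+ n)
  S₂≡∑S₁ ℓ d = begin
    S₂ ℓ d
      ≡⟨ ∑-cong G (λ g → cong (_* ϱ g) (ϱ≡∑𝟙 g)) ⟩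
    ∑[ g ∈ G ] (∑[ n < ℓ ^ 2 ] 𝟙 (isRootMod? g (+ n))) * ϱ g
      ≡˘⟨ ∑-cong G (λ g → ∑<-*ʳ (ℓ ^ 2) (ϱ g) _) ⟩
    ∑[ g ∈ G ] ∑[ n < ℓ ^ 2 ] 𝟙 (isRootMod? g (+ n)) * ϱ g
      ≡⟨ ∑-comm-∑< G (ℓ ^ 2) _ ⟩
    ∑[ n < ℓ ^ 2 ] ∑[ g ∈ G ] 𝟙 (isRootMod? g (+ n)) * ϱ g
      ≡˘⟨ ∑<-cong (ℓ ^ 2) (λ n _ → ∑-filter (λ g → isRootMod? g (+ n)) G ϱ) ⟩
    ∑[ n < ℓ ^ 2 ] S₁ ℓ d (+ n) ∎
    where
    open ≡-Reasoning
    G = allVecs (ℓ ^ 2) (suc d)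

  module _ {ℓ-1 : ℕ} (ℓ-prime : Prime (suc ℓ-1)) where

    open Modℓ² ℓ-prime

    commonRoots-formula : ∀ d n t →
      commonRoots (ℓ ^ 2) (suc d) n t ≡ (ℓ ^ 2) ^ d * gcdℓ² (t ℤ.- n)
    commonRoots-formula d n t = begin
      commonRoots (ℓ ^ 2) (suc d) n t
        ≡⟨ ∑-allVecs-suc (ℓ ^ 2) (suc d) _ ⟩
      ∑[ v ∈ allVecs (ℓ ^ 2) (suc d) ] ∑[ c ∈ allFin (ℓ ^ 2) ]
        𝟙 (isRootMod? (c ∷ v) n) * 𝟙 (isRootMod? (c ∷ v) t)
        ≡⟨ ∑-cong (allVecs (ℓ ^ 2) (suc d)) (λ v → eliminate-constant-term (ℓ ^ 2) v n t) ⟩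
      ∑[ v ∈ allVecs (ℓ ^ 2) (suc d) ] 𝟙 (+ (ℓ ^ 2) ∣? t ℤ.* evalℤ v t ℤ.- n ℤ.* evalℤ v n)
        ≡⟨ ∑-allVecs-suc (ℓ ^ 2) d _ ⟩
      ∑[ h ∈ allVecs (ℓ ^ 2) d ] ∑[ c ∈ allFin (ℓ ^ 2) ]
        𝟙 (+ (ℓ ^ 2) ∣? t ℤ.* evalℤ (c ∷ h) t ℤ.- n ℤ.* evalℤ (c ∷ h) n)
        ≡⟨ ∑-cong (allVecs (ℓ ^ 2) d) (λ h → eliminate-linear-term h n t) ⟩
      ∑[ h ∈ allVecs (ℓ ^ 2) d ] gcdℓ² (t ℤ.- n)
        ≡⟨ ∑-allVecs-const (ℓ ^ 2) d _ ⟩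
      (ℓ ^ 2) ^ d * gcdℓ² (t ℤ.- n) ∎
      where open ≡-Reasoning

    ∑-gcdℓ² : ∀ n → ∑[ t < ℓ ^ 2 ] gcdℓ² (+ t ℤ.- n) ≡ ℓ ^ 2 + ℓ-1 * ℓ + ℓ * ℓ-1
    ∑-gcdℓ² n = begin
      ∑[ t < ℓ ^ 2 ] gcdℓ² (+ t ℤ.- n)
        ≡⟨ ∑<-+ (ℓ ^ 2) (λ t → 1 + ℓ-1 * [ℓ∣t-n] t) (λ t → ℓ * ℓ-1 * [ℓ²∣t-n] t) ⟩
      (∑[ t < ℓ ^ 2 ] (1 + ℓ-1 * [ℓ∣t-n] t)) + (∑[ t < ℓ ^ 2 ] ℓ * ℓ-1 * [ℓ²∣t-n] t)
        ≡⟨ cong₂ _+_ (∑<-+ (ℓ ^ 2) (λ _ → 1) (λ t → ℓ-1 * [ℓ∣t-n] t))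
                     (∑<-*ˡ (ℓ ^ 2) (ℓ * ℓ-1) [ℓ²∣t-n]) ⟩
      (∑[ t < ℓ ^ 2 ] 1) + (∑[ t < ℓ ^ 2 ] ℓ-1 * [ℓ∣t-n] t) + ℓ * ℓ-1 * ∑< (ℓ ^ 2) [ℓ²∣t-n]
        ≡⟨ cong (_+ ℓ * ℓ-1 * ∑< (ℓ ^ 2) [ℓ²∣t-n])
                (cong₂ _+_ (∑<-const (ℓ ^ 2) 1) (∑<-*ˡ (ℓ ^ 2) ℓ-1 [ℓ∣t-n])) ⟩
      ℓ ^ 2 * 1 + ℓ-1 * ∑< (ℓ ^ 2) [ℓ∣t-n] + ℓ * ℓ-1 * ∑< (ℓ ^ 2) [ℓ²∣t-n]
        ≡⟨ cong₂ (λ a b → ℓ ^ 2 * 1 + ℓ-1 * a + ℓ * ℓ-1 * b) ∑[ℓ∣t-n]≡ℓ ∑[ℓ²∣t-n]≡1 ⟩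
      ℓ ^ 2 * 1 + ℓ-1 * ℓ + ℓ * ℓ-1 * 1
        ≡⟨ cong₂ (λ a b → a + ℓ-1 * ℓ + b) (*-identityʳ (ℓ ^ 2)) (*-identityʳ (ℓ * ℓ-1)) ⟩
      ℓ ^ 2 + ℓ-1 * ℓ + ℓ * ℓ-1 ∎
      where
      open ≡-Reasoning
      [ℓ∣t-n] [ℓ²∣t-n] : ℕ → ℕ
      [ℓ∣t-n]  t = 𝟙 (+ ℓ ∣? + t ℤ.- n)
      [ℓ²∣t-n] t = 𝟙 (+ (ℓ ^ 2) ∣? + t ℤ.- n)
      ∑[ℓ∣t-n]≡ℓ : ∑< (ℓ ^ 2) [ℓ∣t-n] ≡ ℓ
      ∑[ℓ∣t-n]≡ℓ = trans (cong (λ m → ∑< m [ℓ∣t-n]) ℓ^2≡ℓ*ℓ) (∑<jk-𝟙[k∣i+a]≡j ℓ ℓ (ℤ.- n))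
      ∑[ℓ²∣t-n]≡1 : ∑< (ℓ ^ 2) [ℓ²∣t-n] ≡ 1
      ∑[ℓ²∣t-n]≡1 = ∑<k-𝟙[k∣i+a]≡1 (ℓ ^ 2) (ℤ.- n)

    S₁-closed-form : ∀ d n → ℓ * S₁ ℓ (suc d) n ≡ ℓ ^ (2 * suc d) * (3 * ℓ ∸ 2)
    S₁-closed-form d n = begin
      ℓ * S₁ ℓ (suc d) n
        ≡⟨ cong (ℓ *_) (S₁≡∑commonRoots ℓ (suc d) n) ⟩
      ℓ * (∑[ t < ℓ ^ 2 ] commonRoots (ℓ ^ 2) (suc d) n (+ t))
        ≡⟨ cong (ℓ *_) (∑<-cong (ℓ ^ 2) (λ t _ → commonRoots-formula d n (+ t))) ⟩
      ℓ * (∑[ t < ℓ ^ 2 ] (ℓ ^ 2) ^ d * gcdℓ² (+ t ℤ.- n))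
        ≡⟨ cong (ℓ *_) (∑<-*ˡ (ℓ ^ 2) ((ℓ ^ 2) ^ d) (λ t → gcdℓ² (+ t ℤ.- n))) ⟩
      ℓ * ((ℓ ^ 2) ^ d * (∑[ t < ℓ ^ 2 ] gcdℓ² (+ t ℤ.- n)))
        ≡⟨ cong (λ s → ℓ * ((ℓ ^ 2) ^ d * s)) (∑-gcdℓ² n) ⟩
      ℓ * ((ℓ ^ 2) ^ d * (ℓ ^ 2 + ℓ-1 * ℓ + ℓ * ℓ-1))
        ≡⟨ collect ℓ-1 ((ℓ ^ 2) ^ d) ⟩
      (ℓ ^ 2) ^ suc d * (3 * ℓ-1 + 1)
        ≡⟨ cong₂ _*_ (^-*-assoc ℓ 2 (suc d)) (sym 3ℓ∸2≡3[ℓ-1]+1) ⟩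
      ℓ ^ (2 * suc d) * (3 * ℓ ∸ 2) ∎
      where
      open ≡-Reasoning
      collect : ∀ p X → (1 + p) * (X * ((1 + p) * ((1 + p) * 1) + p * (1 + p) + (1 + p) * p))
                        ≡ (1 + p) * ((1 + p) * 1) * X * (3 * p + 1)
      collect = solve-∀
      3ℓ∸2≡3[ℓ-1]+1 : 3 * ℓ ∸ 2 ≡ 3 * ℓ-1 + 1
      3ℓ∸2≡3[ℓ-1]+1 = trans (cong (_∸ 2) (expand ℓ-1)) (m+n∸n≡m (3 * ℓ-1 + 1) 2)
        where
        expand : ∀ p → 3 * (1 + p) ≡ 3 * p + 1 + 2
        expand = solve-∀

    S₂-closed-form : ∀ d → ℓ * S₂ ℓ (suc d) ≡ ℓ ^ (2 * suc d + 2) * (3 * ℓ ∸ 2)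
    S₂-closed-form d = begin
      ℓ * S₂ ℓ (suc d)
        ≡⟨ cong (ℓ *_) (S₂≡∑S₁ ℓ (suc d)) ⟩
      ℓ * (∑[ n < ℓ ^ 2 ] S₁ ℓ (suc d) (+ n))
        ≡˘⟨ ∑<-*ˡ (ℓ ^ 2) ℓ (λ n → S₁ ℓ (suc d) (+ n)) ⟩
      ∑[ n < ℓ ^ 2 ] ℓ * S₁ ℓ (suc d) (+ n)
        ≡⟨ ∑<-cong (ℓ ^ 2) (λ n _ → S₁-closed-form d (+ n)) ⟩
      ∑[ n < ℓ ^ 2 ] ℓ ^ (2 * suc d) * (3 * ℓ ∸ 2)
        ≡⟨ ∑<-const (ℓ ^ 2) (ℓ ^ (2 * suc d) * (3 * ℓ ∸ 2)) ⟩
      ℓ ^ 2 * (ℓ ^ (2 * suc d) * (3 * ℓ ∸ 2))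
        ≡˘⟨ *-assoc (ℓ ^ 2) (ℓ ^ (2 * suc d)) (3 * ℓ ∸ 2) ⟩
      ℓ ^ 2 * ℓ ^ (2 * suc d) * (3 * ℓ ∸ 2)
        ≡˘⟨ cong (_* (3 * ℓ ∸ 2)) (trans (^-distribˡ-+-* ℓ (2 * suc d) 2)
                                         (*-comm (ℓ ^ (2 * suc d)) (ℓ ^ 2))) ⟩
      ℓ ^ (2 * suc d + 2) * (3 * ℓ ∸ 2) ∎
      where open ≡-Reasoning

open import Data.Nat using (ℕ; zero; suc; _+_; _*_; _^_; _∸_; _≥_)
open import Data.Nat.Primality using (Prime; ¬prime[0])
open import Data.Integer using (ℤ)
open import Data.Product using (_×_; _,_)
open import Relation.Binary.PropositionalEquality using (_≡_)
open import Relation.Nullary using (contradiction)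
open import Defs
open Counting using (S₁-closed-form; S₂-closed-form)

lemma3p5 : (d ℓ : ℕ) → d ≥ 1 → Prime ℓ → (n : ℤ) →
    (ℓ * S₁ ℓ d n ≡ ℓ ^ (2 * d) * (3 * ℓ ∸ 2))
      × (ℓ * S₂ ℓ d ≡ ℓ ^ (2 * d + 2) * (3 * ℓ ∸ 2))
lemma3p5 zero    _         ()  _       _
lemma3p5 (suc d) zero      _   ℓ-prime _ = contradiction ℓ-prime ¬prime[0]
lemma3p5 (suc d) (suc ℓ-1) _   ℓ-prime n = S₁-closed-form ℓ-prime d n , S₂-closed-form ℓ-prime d
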